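{- For every fixed integer $c\ge 2$, $d(n,c)=\Theta(\log_2 n)$ and $\vec{d}(n,c)=\Theta(\log_2 n)$ as $n\to\infty$.
   Context: All graphs and digraphs are simple. A $c$-edge-colored (di)graph is one with a fixed, not necessarily proper, coloring of its edges (arcs) by colors $1,\dots,c$. A sub(di)graph $H$ is properly colored if no vertex of $H$ is incident to two edges (arcs) of $H$ of the same color; cycles in digraphs are directed cycles. For an undirected $c$-edge-colored graph $G$, $\delta_{mon}(G)=\min_{x,i} d_i(x)$ where $d_i(x)$ is the number of edges of color $i$ incident with $x$; for a $c$-edge-colored digraph $D$, $\delta^+_{mon}(D)=\min_{x,i} d_i^+(x)$ where $d^+_i(x)$ is the number of arcs of color $i$ with tail $x$. $d(n,c)$ is the minimum $k$ such that every $c$-edge-colored undirected graph of order $n$ with $\delta_{mon}\ge k$ has a properly colored cycle; $\vec{d}(n,c)$ is the minimum $k$ such that every $c$-edge-colored digraph of order $n$ with $\delta^+_{mon}\ge k$ has a properly colored cycle. -}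

module Defs where

open import Data.Nat using (ℕ; zero; suc; _+_; _≤_)
open import Data.Nat.DivMod using (_mod_)
open import Data.Fin using (Fin; toℕ) renaming (zero to fzero; suc to fsuc)
import Data.Fin as F
open import Data.Maybe using (Maybe; just; nothing)
open import Data.Bool using (Bool; true; false; if_then_else_)
open import Data.Product using (Σ; _×_)
open import Function using (_∘_)
open import Relation.Nullary using (¬_; does)
open import Relation.Binary.PropositionalEquality using (_≡_; _≢_)

count : ∀ {n} → (Fin n → Bool) → ℕ
count {zero}  f = 0
count {suc n} f = (if f fzero then 1 else 0) + count (f ∘ fsuc)

-- A c-edge-colored simple undirected graph on vertex set Fin n:
-- col x y = nothing  means no edge xy,  col x y = just i  means xy is an edge of color i.
record ECGraph (n c : ℕ) : Set where
  field
    col    : Fin n → Fin n → Maybe (Fin c)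
    irrefl : ∀ x → col x x ≡ nothing
    symm   : ∀ x y → col x y ≡ col y x

-- A c-arc-colored simple digraph on Fin n (no loops, at most one arc x→y;
-- opposite arcs x→y and y→x are allowed).
record ECDigraph (n c : ℕ) : Set where
  field
    col    : Fin n → Fin n → Maybe (Fin c)
    irrefl : ∀ x → col x x ≡ nothing

isColor : ∀ {c} → Maybe (Fin c) → Fin c → Bool
isColor nothing  i = false
isColor (just j) i = does (j F.≟ i)

colDeg : ∀ {n c} → (Fin n → Fin n → Maybe (Fin c)) → Fin n → Fin c → ℕ
colDeg col x i = count (λ y → isColor (col x y) i)

next : ∀ {m} → Fin (suc m) → Fin (suc m)
next {m} j = suc (toℕ j) mod (suc m)

-- A properly colored cycle of length m+1 in the coloured (di)graph given by col:
-- distinct vertices v 0, ..., v m with (arcs) edges v j -> v (j+1 mod (m+1)),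
-- consecutive edges having distinct colours.
record PCCycle {n c : ℕ} (col : Fin n → Fin n → Maybe (Fin c)) (m : ℕ) : Set where
  field
    v        : Fin (suc m) → Fin n
    distinct : ∀ j k → v j ≡ v k → j ≡ k
    isEdge   : ∀ j → col (v j) (v (next j)) ≢ nothing
    proper   : ∀ j → col (v j) (v (next j)) ≢ col (v (next j)) (v (next (next j)))

-- undirected cycles have length ≥ 3
HasPCCycle : ∀ {n c} → ECGraph n c → Set
HasPCCycle G = Σ ℕ (λ m → (2 ≤ m) × PCCycle (ECGraph.col G) m)

-- directed cycles have length ≥ 2
HasPCDiCycle : ∀ {n c} → ECDigraph n c → Set
HasPCDiCycle D = Σ ℕ (λ m → (1 ≤ m) × PCCycle (ECDigraph.col D) m)

MonDegAtLeast : ∀ {n c} → ECGraph n c → ℕ → Set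
MonDegAtLeast G k = ∀ x i → k ≤ colDeg (ECGraph.col G) x i

MonOutDegAtLeast : ∀ {n c} → ECDigraph n c → ℕ → Set
MonOutDegAtLeast D k = ∀ x i → k ≤ colDeg (ECDigraph.col D) x i

ForcesPC : ℕ → ℕ → ℕ → Set
ForcesPC n c k = (G : ECGraph n c) → MonDegAtLeast G k → HasPCCycle G

ForcesPCDi : ℕ → ℕ → ℕ → Set
ForcesPCDi n c k = (D : ECDigraph n c) → MonOutDegAtLeast D k → HasPCDiCycle D

IsMinimum : (ℕ → Set) → ℕ → Set
IsMinimum P k = P k × (∀ j → P j → k ≤ j)

IsD : ℕ → ℕ → ℕ → Set
IsD n c = IsMinimum (ForcesPC n c)

IsDiD : ℕ → ℕ → ℕ → Set
IsDiD n c = IsMinimum (ForcesPCDi n c)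

-- Give every vertex a bit σ x and send x to a neighbour y with σ y = not (σ x)
-- joined to x in colour bit (not (σ x)).  Iterating x ↦ y ends in a cycle on which the colours
-- 0 and 1 alternate, i.e. a properly coloured cycle (of length ≥ 3 if the graph is undirected:
-- the two arcs of a 2-cycle are one edge).  With K ≥ ⌊log₂ n⌋ + 2 neighbours of each colour at
-- every vertex, counting the 2ⁿ choices of σ shows that some σ gives every vertex such a y.
--
-- For a demand d : Fin c → ℕ, join a new apex, in colour b, to all vertices of a
-- copy of the construction for d with d b lowered by one, for each b with d b > 0.  A cycle
-- through the apex stays inside one copy, so it enters and leaves the apex in the same colour:
-- no properly coloured cycle arises.  The construction has at most (c + 2)^(Σ d) vertices, so
-- δ_mon ≥ k is possible without properly coloured cycles once n ≥ (c + 2)^(c k).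

module Submission where

open import Defs
open import Data.Bool using (Bool; true; false; if_then_else_; not; _∧_; _∨_; _xor_)
open import Data.Bool.Properties using (∨-conicalˡ; ∨-conicalʳ; ∨-zeroʳ; not-involutive)
open import Data.Empty using (⊥-elim)
open import Data.Fin using (Fin; zero; suc; toℕ; fromℕ; fromℕ<; splitAt; _↑ˡ_; _↑ʳ_)
import Data.Fin as Fin
open import Data.Fin.Properties
  using (toℕ-injective; toℕ-fromℕ<; toℕ-fromℕ; toℕ<n; toℕ≤pred[n]; toℕ-inject; pigeonhole; ¬∀⟶∃¬-smallest; any?;
         splitAt-↑ˡ; splitAt-↑ʳ; splitAt⁻¹-↑ˡ; splitAt⁻¹-↑ʳ)
open import Data.Maybe using (Maybe; just; nothing)
open import Data.Maybe.Properties using (just-injective)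
open import Data.Nat using (ℕ; zero; suc; _+_; _*_; _∸_; _^_; _≤_; _<_; z≤n; s≤s; _≤?_; _<?_; pred)
open import Data.Nat.DivMod using (_%_; m<n⇒m%n≡m; n%n≡0)
open import Data.Nat.GeneralisedArithmetic using (fold; fold-+)
open import Data.Nat.Logarithm using (⌊log₂_⌋; ⌊log₂⌋-mono-≤; ⌊log₂[2^n]⌋≡n)
open import Data.Nat.Properties
open import Data.Nat.Tactic.RingSolver using (solve-∀)
open import Data.Product using (Σ; ∃; _×_; _,_; proj₁; proj₂)
open import Data.Sum using (_⊎_; inj₁; inj₂; [_,_])
open import Data.Vec.Functional using (foldr; []; _∷_)
open import Function using (_∘_; case_of_)
open import Relation.Binary using (tri<; tri≈; tri>)
open import Relation.Binary.PropositionalEquality hiding ([_])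
open import Relation.Nullary using (¬_; Dec; ¬?; yes; no)
open import Relation.Nullary.Decidable using (decidable-stable; dec-true)

-- Cyclic indices and cycles of a successor function

toℕ-next : ∀ {m} (j : Fin (suc m)) → suc (toℕ j) < suc m → toℕ (next j) ≡ suc (toℕ j)
toℕ-next j lt = trans (toℕ-fromℕ< _) (m<n⇒m%n≡m lt)

next-last : ∀ {m} (j : Fin (suc m)) → toℕ j ≡ m → next j ≡ zero
next-last {m} j eq = toℕ-injective (trans (toℕ-fromℕ< _) (trans (cong (λ t → suc t % suc m) eq) (n%n≡0 (suc m))))

toℕ-fold-next : ∀ {m} (i : Fin (suc m)) t → toℕ i + t ≤ m → toℕ (fold i next t) ≡ toℕ i + t
toℕ-fold-next i zero _ = sym (+-identityʳ _)
toℕ-fold-next i (suc t) le = begin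
  toℕ (next (fold i next t)) ≡⟨ toℕ-next _ (s≤s (subst (_< _) (sym ih) (≤-trans (≤-reflexive (sym (+-suc _ t))) le))) ⟩
  suc (toℕ (fold i next t))  ≡⟨ cong suc ih ⟩
  suc (toℕ i + t)            ≡⟨ +-suc (toℕ i) t ⟨
  toℕ i + suc t              ∎
  where
    open ≡-Reasoning
    ih = toℕ-fold-next i t (≤-trans (+-monoʳ-≤ (toℕ i) (n≤1+n t)) le)

next-induction : ∀ {m} (Q : Fin (suc m) → Set) → (∀ j → Q j → Q (next j)) → ∀ i → Q i → ∀ j → Q j
next-induction {m} Q step i qi j =
  subst Q (toℕ-injective (toℕ-fold-next zero (toℕ j) (toℕ≤pred[n] j))) (along zero q0 (toℕ j))
  where
    along : ∀ i → Q i → ∀ t → Q (fold i next t)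
    along i qi zero = qi
    along i qi (suc t) = step _ (along i qi t)
    fold-to-last : toℕ (fold i next (m ∸ toℕ i)) ≡ m
    fold-to-last = trans (toℕ-fold-next i _ (≤-reflexive i+[m∸i]≡m)) i+[m∸i]≡m
      where i+[m∸i]≡m = m+[n∸m]≡n (toℕ≤pred[n] i)
    q0 : Q zero
    q0 = subst Q (next-last _ fold-to-last) (step _ (along i qi (m ∸ toℕ i)))

next-surjective : ∀ {m} (j : Fin (suc m)) → ∃ λ p → next p ≡ j
next-surjective = next-induction (λ j → ∃ λ p → next p ≡ j) (λ j _ → j , refl) (next zero) (zero , refl)

smallest : (P : ℕ → Set) → (∀ q → Dec (P q)) → ∀ {a} → P a → ∃ λ q → P q × (∀ r → r < q → ¬ P r)
smallest P P? {a} pa with ¬∀⟶∃¬-smallest (suc a) (¬_ ∘ P ∘ toℕ) (λ t → ¬? (P? (toℕ t)))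
                           (λ none → none (fromℕ a) (subst P (sym (toℕ-fromℕ a)) pa))
... | t , ¬¬pt , below = toℕ t , decidable-stable (P? (toℕ t)) ¬¬pt , λ r r<t →
  subst (¬_ ∘ P) (trans (toℕ-inject (fromℕ< r<t)) (toℕ-fromℕ< r<t)) (below (fromℕ< r<t))

record SuccessorCycle {n} (s : Fin n → Fin n) (m : ℕ) : Set where
  field
    v        : Fin (suc m) → Fin n
    distinct : ∀ j k → v j ≡ v k → j ≡ k
    v-next   : ∀ j → v (next j) ≡ s (v j)

minimalPeriod : ∀ {n} (s : Fin n → Fin n) z t → fold z s (suc t) ≡ z → Σ ℕ (SuccessorCycle s)
minimalPeriod {n} s z t periodic
  with smallest (λ q → fold z s (suc q) ≡ z) (λ q → fold z s (suc q) Fin.≟ z) {t} periodic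
... | q , period , minimal = q , record { v = v ; distinct = distinct ; v-next = v-next }
  where
    v : Fin (suc q) → Fin n
    v j = fold z s (toℕ j)
    v-next : ∀ j → v (next j) ≡ s (v j)
    v-next j with m≤n⇒m<n∨m≡n (≤-pred (toℕ<n j))
    ... | inj₁ lt = cong (fold z s) (toℕ-next j (s≤s lt))
    ... | inj₂ eq = trans (cong v (next-last j eq)) (trans (sym period) (cong (s ∘ fold z s) (sym eq)))
    -- A repetition sᵃ z = sᵇ z with a < b ≤ q would make (q ∸ b) + a a shorter period.
    no-repeat : ∀ a b → a < b → b ≤ q → fold z s a ≢ fold z s b
    no-repeat a b a<b b≤q eq = minimal ((q ∸ b) + a) shorter (begin
        fold z s (suc (q ∸ b) + a)          ≡⟨ fold-+ z s (suc (q ∸ b)) ⟩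
        fold (fold z s a) s (suc (q ∸ b))   ≡⟨ cong (λ u → fold u s (suc (q ∸ b))) eq ⟩
        fold (fold z s b) s (suc (q ∸ b))   ≡⟨ fold-+ z s (suc (q ∸ b)) ⟨
        fold z s (suc ((q ∸ b) + b))        ≡⟨ cong (fold z s ∘ suc) (m∸n+n≡m b≤q) ⟩
        fold z s (suc q)                    ≡⟨ period ⟩
        z                                   ∎)
      where
        open ≡-Reasoning
        shorter = subst ((q ∸ b) + a <_) (m∸n+n≡m b≤q) (+-monoʳ-< (q ∸ b) a<b)
    distinct : ∀ j k → v j ≡ v k → j ≡ k
    distinct j k e with <-cmp (toℕ j) (toℕ k)
    ... | tri< lt _ _ = ⊥-elim (no-repeat _ _ lt (≤-pred (toℕ<n k)) e)
    ... | tri≈ _ eq _ = toℕ-injective eq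
    ... | tri> _ _ gt = ⊥-elim (no-repeat _ _ gt (≤-pred (toℕ<n j)) (sym e))

successorCycle : ∀ {n} (s : Fin n → Fin n) → Fin n → Σ ℕ (SuccessorCycle s)
successorCycle {n} s z₀ with pigeonhole (n<1+n n) (fold z₀ s ∘ toℕ)
... | i , j , i<j , repeat with m≤n⇒∃[o]m+o≡n i<j
...   | t , i+t≡j = minimalPeriod s (fold z₀ s (toℕ i)) t (begin
        fold (fold z₀ s (toℕ i)) s (suc t) ≡⟨ fold-+ z₀ s (suc t) ⟨
        fold z₀ s (suc t + toℕ i)          ≡⟨ cong (fold z₀ s) (trans (+-comm (suc t) _) (trans (+-suc _ t) i+t≡j)) ⟩
        fold z₀ s (toℕ j)                  ≡⟨ repeat ⟨
        fold z₀ s (toℕ i)                  ∎)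
  where open ≡-Reasoning

-- Colourings, cones and disjoint unions

count-cong : ∀ {n} {f g : Fin n → Bool} → (∀ y → f y ≡ g y) → count f ≡ count g
count-cong {zero} f≗g = refl
count-cong {suc n} {f} {g} f≗g = cong₂ _+_ (cong (λ b → if b then 1 else 0) (f≗g zero)) (count-cong (f≗g ∘ suc))

count-false : ∀ n → count {n} (λ _ → false) ≡ 0
count-false zero = refl
count-false (suc n) = count-false n

count-true : ∀ n → count {n} (λ _ → true) ≡ n
count-true zero = refl
count-true (suc n) = cong suc (count-true n)

count-≤ : ∀ {n} (f : Fin n → Bool) → count f ≤ n
count-≤ {zero} f = z≤n
count-≤ {suc n} f with f zero
... | true = s≤s (count-≤ (f ∘ suc))
... | false = m≤n⇒m≤1+n (count-≤ (f ∘ suc))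

count-↑ : ∀ m {n} (f : Fin (m + n) → Bool) → count f ≡ count (f ∘ (_↑ˡ n)) + count (f ∘ (m ↑ʳ_))
count-↑ zero f = refl
count-↑ (suc m) f = trans (cong (f₀ +_) (count-↑ m (f ∘ suc))) (sym (+-assoc f₀ _ _))
  where f₀ = if f zero then 1 else 0

Colouring : ℕ → ℕ → Set
Colouring n c = Fin n → Fin n → Maybe (Fin c)

Loopless : ∀ {n c} → Colouring n c → Set
Loopless col = ∀ x → col x x ≡ nothing

Undirected : ∀ {n c} → Colouring n c → Set
Undirected col = ∀ x y → col x y ≡ col y x

PCFree : ∀ {n c} → Colouring n c → Set
PCFree col = ∀ m → ¬ PCCycle col m

record Alternating {n c} (col : Colouring n c) (s : Fin n → Fin n) : Set where
  field
    isArc      : ∀ x → col x (s x) ≢ nothing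
    alternates : ∀ x → col x (s x) ≢ col (s x) (s (s x))

module _ {n c} {col : Colouring n c} {s : Fin n → Fin n} (alternating : Alternating col s) where
  open Alternating alternating

  alternating⇒PCCycle : ∀ {m} → SuccessorCycle s m → PCCycle col m
  alternating⇒PCCycle C = record { v = v ; distinct = distinct ; isEdge = isEdge ; proper = proper }
    where
      open SuccessorCycle C
      arc : ∀ j → col (v j) (v (next j)) ≡ col (v j) (s (v j))
      arc j = cong (col (v j)) (v-next j)
      isEdge : ∀ j → col (v j) (v (next j)) ≢ nothing
      isEdge j = isArc (v j) ∘ trans (sym (arc j))
      proper : ∀ j → col (v j) (v (next j)) ≢ col (v (next j)) (v (next (next j)))
      proper j e = alternates (v j)
        (trans (sym (arc j)) (trans e (trans (arc (next j)) (cong (λ u → col u (s u)) (v-next j)))))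

  successorCycle-length≥1 : ∀ {m} → SuccessorCycle s m → 1 ≤ m
  successorCycle-length≥1 {zero} C = ⊥-elim (alternates (v zero) (cong (λ u → col u (s u)) (v-next zero)))
    where open SuccessorCycle C
  successorCycle-length≥1 {suc m} C = s≤s z≤n

  successorCycle-length≥2 : Undirected col → ∀ {m} → SuccessorCycle s m → 2 ≤ m
  successorCycle-length≥2 _ {zero} C = ⊥-elim (<-irrefl refl (successorCycle-length≥1 C))
  successorCycle-length≥2 undirected {suc zero} C = ⊥-elim (alternates a (begin
      col a (s a)         ≡⟨ cong (col a) (v-next zero) ⟨
      col a b             ≡⟨ undirected a b ⟩
      col b a             ≡⟨ cong₂ col (v-next zero) (v-next (suc zero)) ⟩
      col (s a) (s b)     ≡⟨ cong (λ u → col (s a) (s u)) (v-next zero) ⟩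
      col (s a) (s (s a)) ∎))
    where
      open SuccessorCycle C
      open ≡-Reasoning
      a = v zero
      b = v (suc zero)
  successorCycle-length≥2 _ {suc (suc m)} C = s≤s (s≤s z≤n)

  alternating⇒HasPCDiCycle : Fin n → Σ ℕ λ m → 1 ≤ m × PCCycle col m
  alternating⇒HasPCDiCycle z = cycle (successorCycle s z)
    where
      cycle : Σ ℕ (SuccessorCycle s) → Σ ℕ λ m → 1 ≤ m × PCCycle col m
      cycle (m , C) = m , successorCycle-length≥1 C , alternating⇒PCCycle C

  alternating⇒HasPCCycle : Undirected col → Fin n → Σ ℕ λ m → 2 ≤ m × PCCycle col m
  alternating⇒HasPCCycle undirected z = cycle (successorCycle s z)
    where
      cycle : Σ ℕ (SuccessorCycle s) → Σ ℕ λ m → 2 ≤ m × PCCycle col m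
      cycle (m , C) = m , successorCycle-length≥2 undirected C , alternating⇒PCCycle C

pullbackPCCycle : ∀ {m n c k} {col : Colouring m c} {col′ : Colouring n c} (ι : Fin m → Fin n) →
  (∀ a b → col′ (ι a) (ι b) ≡ col a b) → (C : PCCycle col′ k) →
  (∀ j → ∃ λ a → ι a ≡ PCCycle.v C j) → PCCycle col k
pullbackPCCycle {col = col} {col′} ι ι-colour C preimage = record
  { v        = w
  ; distinct = λ j k e → distinct j k (trans (sym (ι-w j)) (trans (cong ι e) (ι-w k)))
  ; isEdge   = λ j e → isEdge j (trans (colour j (next j)) e)
  ; proper   = λ j e → proper j (trans (colour j (next j)) (trans e (sym (colour (next j) (next (next j))))))
  }
  where
    open PCCycle C
    w = proj₁ ∘ preimage
    ι-w = proj₂ ∘ preimage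
    colour : ∀ j k → col′ (v j) (v k) ≡ col (w j) (w k)
    colour j k = trans (sym (cong₂ col′ (ι-w j) (ι-w k))) (ι-colour (w j) (w k))

image-closed : ∀ {m n c k} {col′ : Colouring n c} (ι : Fin m → Fin n) →
  (∀ a y → col′ (ι a) y ≢ nothing → ∃ λ b → ι b ≡ y) → (C : PCCycle col′ k) →
  ∀ i → (∃ λ a → ι a ≡ PCCycle.v C i) → ∀ j → ∃ λ a → ι a ≡ PCCycle.v C j
image-closed {col′ = col′} ι closed C = next-induction _ step
  where
    open PCCycle C
    step : ∀ j → (∃ λ a → ι a ≡ v j) → ∃ λ b → ι b ≡ v (next j)
    step j (a , e) = closed a (v (next j)) (isEdge j ∘ trans (cong (λ u → col′ u (v (next j))) (sym e)))

emptyColouring : ∀ {n c} → Colouring n c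
emptyColouring _ _ = nothing

emptyColouring-pcFree : ∀ {n c} → PCFree (emptyColouring {n} {c})
emptyColouring-pcFree m C = PCCycle.isEdge C zero refl

nonzero⇒suc : ∀ {n} (x : Fin (suc n)) → x ≢ zero → ∃ λ a → suc a ≡ x
nonzero⇒suc zero x≢0 = ⊥-elim (x≢0 refl)
nonzero⇒suc (suc a) _ = a , refl

ConstantOnEdges : ∀ {n c} → (Fin n → Fin c) → Colouring n c → Set
ConstantOnEdges φ col = ∀ x y → col x y ≢ nothing → φ x ≡ φ y

cone : ∀ {n c} → (Fin n → Fin c) → Colouring n c → Colouring (suc n) c
cone φ col zero    zero    = nothing
cone φ col zero    (suc y) = just (φ y)
cone φ col (suc x) zero    = just (φ x)
cone φ col (suc x) (suc y) = col x y

cone-loopless : ∀ {n c} (φ : Fin n → Fin c) {col} → Loopless col → Loopless (cone φ col)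
cone-loopless φ loopless zero = refl
cone-loopless φ loopless (suc x) = loopless x

cone-undirected : ∀ {n c} (φ : Fin n → Fin c) {col} → Undirected col → Undirected (cone φ col)
cone-undirected φ undirected zero    zero    = refl
cone-undirected φ undirected zero    (suc y) = refl
cone-undirected φ undirected (suc x) zero    = refl
cone-undirected φ undirected (suc x) (suc y) = undirected x y

cone-pcFree : ∀ {n c} (φ : Fin n → Fin c) {col} → PCFree col → ConstantOnEdges φ col → PCFree (cone φ col)
cone-pcFree φ {col} pcFree constant m C with any? (λ j → PCCycle.v C j Fin.≟ zero)
... | no avoids = pcFree m (pullbackPCCycle suc (λ _ _ → refl) C (λ j → nonzero⇒suc _ (avoids ∘ (j ,_))))
... | yes (j₀ , apex) = proper p (begin
      cone φ col (v p) (v (next p))               ≡⟨ cong₂ (cone φ col) (sym vp) vnp ⟩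
      just (φ x)                                  ≡⟨ cong just φx ⟩
      just (φ u)                                  ≡⟨ cong₂ (cone φ col) vnp (trans (cong (v ∘ next) p→j₀) (sym vu)) ⟨
      cone φ col (v (next p)) (v (next (next p))) ∎)
  where
    open PCCycle C
    open ≡-Reasoning
    exit = nonzero⇒suc (v (next j₀)) (λ e → isEdge j₀ (cong₂ (cone φ col) apex e))
    u = proj₁ exit
    vu = proj₂ exit
    InClass : Fin (suc m) → Set
    InClass j = v j ≡ zero ⊎ ∃ λ x → suc x ≡ v j × φ x ≡ φ u
    step : ∀ j → InClass j → InClass (next j)
    step j (inj₁ e) rewrite distinct j j₀ (trans e (sym apex)) = inj₂ (u , vu , refl)
    step j (inj₂ (x , e , φx)) with v (next j) | isEdge j
    ... | zero  | _ = inj₁ refl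
    ... | suc y | edge =
      inj₂ (y , refl , trans (sym (constant x y (edge ∘ trans (sym (cong (λ z → cone φ col z (suc y)) e))))) φx)
    p = proj₁ (next-surjective j₀)
    p→j₀ = proj₂ (next-surjective j₀)
    vnp : v (next p) ≡ zero
    vnp = trans (cong v p→j₀) apex
    last : ∃ λ x → suc x ≡ v p × φ x ≡ φ u
    last with next-induction InClass step j₀ (inj₁ apex) p
    ... | inj₂ x = x
    ... | inj₁ e with () ← trans vu (trans (cong (v ∘ next) (sym (distinct p j₀ (trans e (sym apex))))) vnp)
    x = proj₁ last
    vp = proj₁ (proj₂ last)
    φx = proj₂ (proj₂ last)

splitAt-elim : ∀ m {n} (P : Fin (m + n) → Set) → (∀ a → P (a ↑ˡ n)) → (∀ b → P (m ↑ʳ b)) → ∀ x → P x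
splitAt-elim m P left right x with splitAt m x in e
... | inj₁ a = subst P (splitAt⁻¹-↑ˡ e) (left a)
... | inj₂ b = subst P (splitAt⁻¹-↑ʳ e) (right b)

sumColouring : ∀ {m n c} → Colouring m c → Colouring n c → Fin m ⊎ Fin n → Fin m ⊎ Fin n → Maybe (Fin c)
sumColouring G H (inj₁ a) (inj₁ b) = G a b
sumColouring G H (inj₂ a) (inj₂ b) = H a b
sumColouring G H _        _        = nothing

_⊕_ : ∀ {m n c} → Colouring m c → Colouring n c → Colouring (m + n) c
_⊕_ {m} G H x y = sumColouring G H (splitAt m x) (splitAt m y)

module _ {m n c} (G : Colouring m c) (H : Colouring n c) where

  ⊕-↑ˡ↑ˡ : ∀ a b → (G ⊕ H) (a ↑ˡ n) (b ↑ˡ n) ≡ G a b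
  ⊕-↑ˡ↑ˡ a b rewrite splitAt-↑ˡ m a n | splitAt-↑ˡ m b n = refl

  ⊕-↑ˡ↑ʳ : ∀ a b → (G ⊕ H) (a ↑ˡ n) (m ↑ʳ b) ≡ nothing
  ⊕-↑ˡ↑ʳ a b rewrite splitAt-↑ˡ m a n | splitAt-↑ʳ m n b = refl

  ⊕-↑ʳ↑ˡ : ∀ a b → (G ⊕ H) (m ↑ʳ a) (b ↑ˡ n) ≡ nothing
  ⊕-↑ʳ↑ˡ a b rewrite splitAt-↑ʳ m n a | splitAt-↑ˡ m b n = refl

  ⊕-↑ʳ↑ʳ : ∀ a b → (G ⊕ H) (m ↑ʳ a) (m ↑ʳ b) ≡ H a b
  ⊕-↑ʳ↑ʳ a b rewrite splitAt-↑ʳ m n a | splitAt-↑ʳ m n b = refl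

  ⊕-loopless : Loopless G → Loopless H → Loopless (G ⊕ H)
  ⊕-loopless loopG loopH = splitAt-elim m _
    (λ a → trans (⊕-↑ˡ↑ˡ a a) (loopG a)) (λ b → trans (⊕-↑ʳ↑ʳ b b) (loopH b))

  ⊕-undirected : Undirected G → Undirected H → Undirected (G ⊕ H)
  ⊕-undirected symG symH = splitAt-elim m _
    (λ a → splitAt-elim m _ (λ b → trans (⊕-↑ˡ↑ˡ a b) (trans (symG a b) (sym (⊕-↑ˡ↑ˡ b a))))
                            (λ b → trans (⊕-↑ˡ↑ʳ a b) (sym (⊕-↑ʳ↑ˡ b a))))
    (λ a → splitAt-elim m _ (λ b → trans (⊕-↑ʳ↑ˡ a b) (sym (⊕-↑ˡ↑ʳ b a)))
                            (λ b → trans (⊕-↑ʳ↑ʳ a b) (trans (symH a b) (sym (⊕-↑ʳ↑ʳ b a)))))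

  ⊕-pcFree : PCFree G → PCFree H → PCFree (G ⊕ H)
  ⊕-pcFree pcFreeG pcFreeH k C with splitAt m (PCCycle.v C zero) in e
  ... | inj₁ a = pcFreeG k (pullbackPCCycle (_↑ˡ n) ⊕-↑ˡ↑ˡ C
          (image-closed (_↑ˡ n) closedˡ C zero (a , splitAt⁻¹-↑ˡ e)))
    where
      closedˡ : ∀ a y → (G ⊕ H) (a ↑ˡ n) y ≢ nothing → ∃ λ b → b ↑ˡ n ≡ y
      closedˡ a = splitAt-elim m _ (λ b _ → b , refl) (λ b edge → ⊥-elim (edge (⊕-↑ˡ↑ʳ a b)))
  ... | inj₂ b = pcFreeH k (pullbackPCCycle (m ↑ʳ_) ⊕-↑ʳ↑ʳ C
          (image-closed (m ↑ʳ_) closedʳ C zero (b , splitAt⁻¹-↑ʳ e)))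
    where
      closedʳ : ∀ a y → (G ⊕ H) (m ↑ʳ a) y ≢ nothing → ∃ λ b → m ↑ʳ b ≡ y
      closedʳ a = splitAt-elim m _ (λ b edge → ⊥-elim (edge (⊕-↑ʳ↑ˡ a b))) (λ b _ → b , refl)

  colDeg-⊕-↑ˡ : ∀ a i → colDeg (G ⊕ H) (a ↑ˡ n) i ≡ colDeg G a i
  colDeg-⊕-↑ˡ a i = begin
    colDeg (G ⊕ H) (a ↑ˡ n) i
      ≡⟨ count-↑ m _ ⟩
    count (λ b → isColor ((G ⊕ H) (a ↑ˡ n) (b ↑ˡ n)) i) + count (λ b → isColor ((G ⊕ H) (a ↑ˡ n) (m ↑ʳ b)) i)
      ≡⟨ cong₂ _+_ (count-cong (λ b → cong (λ z → isColor z i) (⊕-↑ˡ↑ˡ a b)))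
                   (count-cong (λ b → cong (λ z → isColor z i) (⊕-↑ˡ↑ʳ a b))) ⟩
    colDeg G a i + count {n} (λ _ → false)
      ≡⟨ cong (colDeg G a i +_) (count-false n) ⟩
    colDeg G a i + 0
      ≡⟨ +-identityʳ _ ⟩
    colDeg G a i ∎
    where open ≡-Reasoning

  colDeg-⊕-↑ʳ : ∀ a i → colDeg (G ⊕ H) (m ↑ʳ a) i ≡ colDeg H a i
  colDeg-⊕-↑ʳ a i = begin
    colDeg (G ⊕ H) (m ↑ʳ a) i
      ≡⟨ count-↑ m _ ⟩
    count (λ b → isColor ((G ⊕ H) (m ↑ʳ a) (b ↑ˡ n)) i) + count (λ b → isColor ((G ⊕ H) (m ↑ʳ a) (m ↑ʳ b)) i)
      ≡⟨ cong₂ _+_ (count-cong (λ b → cong (λ z → isColor z i) (⊕-↑ʳ↑ˡ a b)))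
                   (count-cong (λ b → cong (λ z → isColor z i) (⊕-↑ʳ↑ʳ a b))) ⟩
    count {m} (λ _ → false) + colDeg H a i
      ≡⟨ cong (_+ colDeg H a i) (count-false m) ⟩
    colDeg H a i ∎
    where open ≡-Reasoning

-- Properly-coloured-cycle-free graphs with large monochromatic degrees

record PCFreeGraph (n c : ℕ) (d : Fin c → ℕ) : Set where
  field
    colour     : Colouring n c
    loopless   : Loopless colour
    undirected : Undirected colour
    pcFree     : PCFree colour
    minColDeg  : ∀ x b → d b ≤ colDeg colour x b

-- The vertices are to be joined to a new apex in colour label; minColDeg counts that edge.
record PCFreeForest (n c : ℕ) (d : Fin c → ℕ) : Set where
  field
    colour         : Colouring n c
    loopless       : Loopless colour
    undirected     : Undirected colour
    pcFree         : PCFree colour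
    label          : Fin n → Fin c
    label-constant : ConstantOnEdges label colour
    minColDeg      : ∀ x b → d b ≤ colDeg (cone label colour) (suc x) b

  apexDeg : Fin c → ℕ
  apexDeg = colDeg (cone label colour) zero

module _ {n c} {d : Fin c → ℕ} (F : PCFreeForest n c d) where
  open PCFreeForest F

  coneGraph : (∀ b → d b ≤ apexDeg b) → PCFreeGraph (suc n) c d
  coneGraph apexMinColDeg = record
    { colour     = cone label colour
    ; loopless   = cone-loopless label loopless
    ; undirected = cone-undirected label undirected
    ; pcFree     = cone-pcFree label pcFree label-constant
    ; minColDeg  = λ { zero → apexMinColDeg ; (suc x) → minColDeg x }
    }

lower : ∀ {c} → (Fin c → ℕ) → Fin c → Fin c → ℕ
lower d b b′ = if isColor (just b) b′ then pred (d b′) else d b′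

module _ {n c} {d : Fin c → ℕ} (b : Fin c) (G : PCFreeGraph n c (lower d b)) where
  open PCFreeGraph G

  asForest : PCFreeForest n c d
  asForest = record
    { colour = colour ; loopless = loopless ; undirected = undirected ; pcFree = pcFree
    ; label = λ _ → b ; label-constant = λ _ _ _ → refl ; minColDeg = minColDeg′ }
    where
      minColDeg′ : ∀ x b′ → d b′ ≤ (if isColor (just b) b′ then 1 else 0) + colDeg colour x b′
      minColDeg′ x b′ with isColor (just b) b′ | minColDeg x b′
      ... | false | deg = deg
      ... | true  | deg with d b′
      ...   | zero  = z≤n
      ...   | suc _ = s≤s deg

  asForest-apexDeg : PCFreeForest.apexDeg asForest b ≡ n
  asForest-apexDeg = trans (count-cong {n} (λ _ → dec-true (b Fin.≟ b) refl)) (count-true n)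

module _ {m n c} {d : Fin c → ℕ} (F : PCFreeForest m c d) (F′ : PCFreeForest n c d) where
  private
    module F = PCFreeForest F
    module F′ = PCFreeForest F′

  label⊕ : Fin (m + n) → Fin c
  label⊕ = [ F.label , F′.label ] ∘ splitAt m

  infixr 5 _⊕ᶠ_
  _⊕ᶠ_ : PCFreeForest (m + n) c d
  _⊕ᶠ_ = record
    { colour         = G
    ; loopless       = ⊕-loopless F.colour F′.colour F.loopless F′.loopless
    ; undirected     = ⊕-undirected F.colour F′.colour F.undirected F′.undirected
    ; pcFree         = ⊕-pcFree F.colour F′.colour F.pcFree F′.pcFree
    ; label          = label⊕
    ; label-constant = label⊕-constant
    ; minColDeg      = minColDeg⊕
    }
    where
      G = F.colour ⊕ F′.colour
      labelˡ : ∀ a → label⊕ (a ↑ˡ n) ≡ F.label a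
      labelˡ a = cong [ F.label , F′.label ] (splitAt-↑ˡ m a n)
      labelʳ : ∀ a → label⊕ (m ↑ʳ a) ≡ F′.label a
      labelʳ a = cong [ F.label , F′.label ] (splitAt-↑ʳ m n a)
      label⊕-constant : ConstantOnEdges label⊕ G
      label⊕-constant = splitAt-elim m _
        (λ a → splitAt-elim m _
          (λ b e → subst₂ _≡_ (sym (labelˡ a)) (sym (labelˡ b))
                     (F.label-constant a b (e ∘ trans (⊕-↑ˡ↑ˡ F.colour F′.colour a b))))
          (λ b e → ⊥-elim (e (⊕-↑ˡ↑ʳ F.colour F′.colour a b))))
        (λ a → splitAt-elim m _
          (λ b e → ⊥-elim (e (⊕-↑ʳ↑ˡ F.colour F′.colour a b)))
          (λ b e → subst₂ _≡_ (sym (labelʳ a)) (sym (labelʳ b))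
                     (F′.label-constant a b (e ∘ trans (⊕-↑ʳ↑ʳ F.colour F′.colour a b)))))
      Meets : Fin c → Fin c → ℕ → Set
      Meets b ℓ k = d b ≤ (if isColor (just ℓ) b then 1 else 0) + k
      minColDeg⊕ : ∀ x b → d b ≤ colDeg (cone label⊕ G) (suc x) b
      minColDeg⊕ = splitAt-elim m _
        (λ a b → subst₂ (Meets b) (sym (labelˡ a)) (sym (colDeg-⊕-↑ˡ F.colour F′.colour a b)) (F.minColDeg a b))
        (λ a b → subst₂ (Meets b) (sym (labelʳ a)) (sym (colDeg-⊕-↑ʳ F.colour F′.colour a b)) (F′.minColDeg a b))

  ⊕ᶠ-apexDeg : ∀ b → PCFreeForest.apexDeg _⊕ᶠ_ b ≡ F.apexDeg b + F′.apexDeg b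
  ⊕ᶠ-apexDeg b = trans (count-↑ m _) (cong₂ _+_
    (count-cong (λ a → cong (λ ℓ → isColor (just ([ F.label , F′.label ] ℓ)) b) (splitAt-↑ˡ m a n)))
    (count-cong (λ a → cong (λ ℓ → isColor (just ([ F.label , F′.label ] ℓ)) b) (splitAt-↑ʳ m n a))))

  ⊕ᶠ-apexDegˡ : ∀ b → F.apexDeg b ≤ PCFreeForest.apexDeg _⊕ᶠ_ b
  ⊕ᶠ-apexDegˡ b = subst (F.apexDeg b ≤_) (sym (⊕ᶠ-apexDeg b)) (m≤m+n _ _)

  ⊕ᶠ-apexDegʳ : ∀ b → F′.apexDeg b ≤ PCFreeForest.apexDeg _⊕ᶠ_ b
  ⊕ᶠ-apexDegʳ b = subst (F′.apexDeg b ≤_) (sym (⊕ᶠ-apexDeg b)) (m≤n+m _ _)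

emptyForest : ∀ {c} {d : Fin c → ℕ} → PCFreeForest 0 c d
emptyForest = record
  { colour = emptyColouring ; loopless = λ () ; undirected = λ () ; pcFree = emptyColouring-pcFree
  ; label = λ () ; label-constant = λ () ; minColDeg = λ () }

total : ∀ {c} → (Fin c → ℕ) → ℕ
total = foldr _+_ 0

total-lower : ∀ {c} (d : Fin c → ℕ) b → 0 < d b → suc (total (lower d b)) ≡ total d
total-lower d zero pos with d zero
... | suc _ = refl
total-lower d (suc b) pos = trans (sym (+-suc (d zero) _)) (cong (d zero +_) (total-lower (d ∘ suc) b pos))

total-const : ∀ c k → total {c} (λ _ → k) ≡ c * k
total-const zero k = refl
total-const (suc c) k = cong (k +_) (total-const c k)

lower-self : ∀ {c} (d : Fin c → ℕ) b → lower d b b ≡ pred (d b)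
lower-self d b rewrite dec-true (b Fin.≟ b) refl = refl

pred<⇒≤ : ∀ {m n} → pred m < n → m ≤ n
pred<⇒≤ {zero} _ = z≤n
pred<⇒≤ {suc m} lt = lt

-- The padding e is passed down the recursion and ends as isolated vertices of the trivial family,
-- where the cones above supply all their edges.
record PCFreeFamily (c D : ℕ) (d : Fin c → ℕ) : Set where
  field
    size        : ℕ
    demand<size : ∀ b → d b < size
    size≤       : size ≤ (2 + c) ^ D
    graph       : ∀ e → PCFreeGraph (size + e) c d

trivialFamily : ∀ {c} D (d : Fin c → ℕ) → (∀ b → d b ≡ 0) → PCFreeFamily c D d
trivialFamily {c} D d zero-demand = record
  { size = 1 ; demand<size = λ b → s≤s (≤-reflexive (zero-demand b)) ; size≤ = m^n>0 (2 + c) D ; graph = graph }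
  where
    graph : ∀ e → PCFreeGraph (1 + e) c d
    graph e = record
      { colour = emptyColouring ; loopless = λ _ → refl ; undirected = λ _ _ → refl ; pcFree = emptyColouring-pcFree
      ; minColDeg = λ _ b → subst (_≤ _) (sym (zero-demand b)) z≤n }

module _ {c D} (d : Fin c → ℕ) (child : ∀ b → 0 < d b → PCFreeFamily c D (lower d b)) where

  demand≤childApexDeg : ∀ b pos e →
    d b ≤ PCFreeForest.apexDeg (asForest b (PCFreeFamily.graph (child b pos) e)) b
  demand≤childApexDeg b pos e = subst (d b ≤_) (sym (asForest-apexDeg b (graph e)))
    (≤-trans (pred<⇒≤ (subst (_< size) (lower-self d b) (demand<size b))) (m≤m+n size e))
    where open PCFreeFamily (child b pos)

  Covering : ∀ {k} → (Fin k → Fin c) → ℕ → Set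
  Covering bs F = Σ (PCFreeForest F c d) λ forest → ∀ i → d (bs i) ≤ PCFreeForest.apexDeg forest (bs i)

  covering : ∀ {k} (bs : Fin k → Fin c) → Σ ℕ λ F → F ≤ k * (2 + c) ^ D × Covering bs F
  covering {zero} bs = 0 , z≤n , emptyForest , λ ()
  covering {suc k} bs with 0 <? d (bs zero) | covering (bs ∘ suc)
  ... | no ¬pos | F , F≤ , forest , covers = F , ≤-trans F≤ (m≤n+m _ _) , forest , λ where
        zero    → subst (_≤ _) (sym (n≤0⇒n≡0 (≮⇒≥ ¬pos))) z≤n
        (suc i) → covers i
  ... | yes pos | F , F≤ , forest , covers = size + 0 + F , +-mono-≤ size+0≤ F≤ , tree ⊕ᶠ forest , λ where
        zero    → ≤-trans (demand≤childApexDeg (bs zero) pos 0) (⊕ᶠ-apexDegˡ tree forest (bs zero))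
        (suc i) → ≤-trans (covers i) (⊕ᶠ-apexDegʳ tree forest (bs (suc i)))
    where
      open PCFreeFamily (child (bs zero) pos)
      tree = asForest (bs zero) (graph 0)
      size+0≤ : size + 0 ≤ (2 + c) ^ D
      size+0≤ = ≤-trans (≤-reflexive (+-identityʳ size)) size≤

  extend : ∀ b → 0 < d b → PCFreeFamily c (suc D) d
  extend b pos = record { size = suc (size + F) ; demand<size = demand<size′ ; size≤ = size≤′ ; graph = graph′ }
    where
      open PCFreeFamily (child b pos)
      cover = covering (λ i → i)
      F = proj₁ cover
      forest = proj₁ (proj₂ (proj₂ cover))
      covers = proj₂ (proj₂ (proj₂ cover))
      demand<size′ : ∀ b′ → d b′ < suc (size + F)
      demand<size′ b′ = s≤s (≤-trans (covers b′) (≤-trans (count-≤ _) (m≤n+m F size)))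
      size≤′ : suc (size + F) ≤ (2 + c) ^ suc D
      size≤′ = +-mono-≤ (m^n>0 (2 + c) D) (+-mono-≤ size≤ (proj₁ (proj₂ cover)))
      +-comm-middle : ∀ x y z → x + y + z ≡ x + z + y
      +-comm-middle = solve-∀
      graph′ : ∀ e → PCFreeGraph (suc (size + F) + e) c d
      graph′ e = subst (λ s → PCFreeGraph s c d) (cong suc (+-comm-middle size e F))
        (coneGraph (tree ⊕ᶠ forest) λ b′ → ≤-trans (covers b′) (⊕ᶠ-apexDegʳ tree forest b′))
        where tree = asForest b (graph e)

pcFreeFamily : ∀ {c} D (d : Fin c → ℕ) → total d ≤ D → PCFreeFamily c D d
pcFreeFamily D d total≤D with any? (λ b → 0 <? d b)
... | no none = trivialFamily D d (λ b → n≤0⇒n≡0 (≮⇒≥ (none ∘ (b ,_))))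
pcFreeFamily zero d total≤0 | yes (b , pos) = ⊥-elim (n≮0 (subst (_≤ 0) (sym (total-lower d b pos)) total≤0))
pcFreeFamily (suc D) d total≤D | yes (b , pos) =
  extend d (λ b′ pos′ → pcFreeFamily D (lower d b′) (≤-pred (subst (_≤ suc D) (sym (total-lower d b′ pos′)) total≤D)))
    b pos

pcFreeGraph : ∀ c k n → (2 + c) ^ (c * k) ≤ n → PCFreeGraph n c (λ _ → k)
pcFreeGraph c k n large =
  subst (λ s → PCFreeGraph s c (λ _ → k)) (m+[n∸m]≡n (≤-trans size≤ large)) (graph (n ∸ size))
  where open PCFreeFamily (pcFreeFamily {c} (c * k) (λ _ → k) (≤-reflexive (total-const c k)))

-- Counting Boolean assignments

#sat : ∀ {n} → ((Fin n → Bool) → Bool) → ℕ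
#sat {zero}  p = if p [] then 1 else 0
#sat {suc n} p = #sat (p ∘ (false ∷_)) + #sat (p ∘ (true ∷_))

#sat-false : ∀ n → #sat {n} (λ _ → false) ≡ 0
#sat-false zero = refl
#sat-false (suc n) = cong₂ _+_ (#sat-false n) (#sat-false n)

#sat-∧ : ∀ {n} g (q : (Fin n → Bool) → Bool) → #sat (λ σ → g ∧ q σ) ≡ (if g then #sat q else 0)
#sat-∧ true q = refl
#sat-∧ {n} false q = #sat-false n

#sat-∨ : ∀ {n} {p q r : (Fin n → Bool) → Bool} → (∀ σ → p σ ≡ true → q σ ∨ r σ ≡ true) →
  #sat p ≤ #sat q + #sat r
#sat-∨ {zero} {p} {q} {r} p⇒q∨r with p [] | q [] | r [] | p⇒q∨r []
... | false | _     | _     | _ = z≤n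
... | true  | true  | _     | _ = s≤s z≤n
... | true  | false | true  | _ = s≤s z≤n
... | true  | false | false | p⇒ with () ← p⇒ refl
#sat-∨ {suc n} {p} {q} {r} p⇒q∨r = ≤-trans
  (+-mono-≤ (#sat-∨ {q = q ∘ (false ∷_)} {r ∘ (false ∷_)} (p⇒q∨r ∘ (false ∷_)))
            (#sat-∨ {q = q ∘ (true ∷_)} {r ∘ (true ∷_)} (p⇒q∨r ∘ (true ∷_))))
  (≤-reflexive (interchange (#sat (q ∘ (false ∷_))) (#sat (r ∘ (false ∷_))) (#sat (q ∘ (true ∷_))) _))
  where
    interchange : ∀ a b c d → (a + b) + (c + d) ≡ (a + c) + (b + d)
    interchange = solve-∀

#sat<⇒falsifiable : ∀ {n} (p : (Fin n → Bool) → Bool) → #sat p < 2 ^ n → ∃ λ σ → p σ ≡ false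
#sat<⇒falsifiable {zero} p lt with p [] in e
... | false = [] , e
... | true  = ⊥-elim (<-irrefl refl lt)
#sat<⇒falsifiable {suc n} p lt with #sat (p ∘ (false ∷_)) <? 2 ^ n
... | yes lt₀ = let σ , e = #sat<⇒falsifiable (p ∘ (false ∷_)) lt₀ in false ∷ σ , e
... | no ¬lt₀ = let σ , e = #sat<⇒falsifiable (p ∘ (true ∷_)) lt₁ in true ∷ σ , e
  where
    lt₁ : #sat (p ∘ (true ∷_)) < 2 ^ n
    lt₁ = +-cancelˡ-< (2 ^ n) _ _
      (≤-<-trans (+-monoˡ-≤ _ (≮⇒≥ ¬lt₀)) (subst (#sat p <_) (cong (2 ^ n +_) (+-identityʳ (2 ^ n))) lt))

constantOn : ∀ {n} → (Fin n → Bool) → Bool → (Fin n → Bool) → Bool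
constantOn S b σ = foldr _∧_ true (λ x → not (S x) ∨ not (σ x xor b))

xor≡true⇒≡not : ∀ a b → a xor b ≡ true → a ≡ not b
xor≡true⇒≡not false true  _ = refl
xor≡true⇒≡not true  false _ = refl

constantOn-false : ∀ {n} (S : Fin n → Bool) b σ → constantOn S b σ ≡ false → ∃ λ y → S y ≡ true × σ y ≡ not b
constantOn-false {suc n} S b σ e with S zero in S₀ | σ zero xor b in differs
... | true  | true  = zero , S₀ , xor≡true⇒≡not (σ zero) b differs
... | true  | false = let y , Sy , σy = constantOn-false (S ∘ suc) b (σ ∘ suc) e in suc y , Sy , σy
... | false | _     = let y , Sy , σy = constantOn-false (S ∘ suc) b (σ ∘ suc) e in suc y , Sy , σy

#sat-constantOn : ∀ {n} (S : Fin n → Bool) b → #sat (constantOn S b) * 2 ^ count S ≡ 2 ^ n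
#sat-constantOn {zero} S b = refl
#sat-constantOn {suc n} S b = begin
  (#sat (λ σ → guard false ∧ constantOn (S ∘ suc) b σ) + #sat (λ σ → guard true ∧ constantOn (S ∘ suc) b σ))
    * 2 ^ count S
    ≡⟨ cong (λ k → k * 2 ^ count S) (cong₂ _+_ (#sat-∧ {n} (guard false) _) (#sat-∧ {n} (guard true) _)) ⟩
  ((if guard false then C else 0) + (if guard true then C else 0)) * 2 ^ ((if S zero then 1 else 0) + count (S ∘ suc))
    ≡⟨ split (S zero) b ⟩
  2 ^ suc n ∎
  where
    open ≡-Reasoning
    guard : Bool → Bool
    guard β = not (S zero) ∨ not (β xor b)
    C = #sat (constantOn (S ∘ suc) b)
    E = 2 ^ count (S ∘ suc)
    IH : C * E ≡ 2 ^ n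
    IH = #sat-constantOn (S ∘ suc) b
    both : ∀ x y → (x + x) * y ≡ 2 * (x * y)
    both = solve-∀
    first : ∀ x y → (x + 0) * (2 * y) ≡ 2 * (x * y)
    first = solve-∀
    second : ∀ x y → (0 + x) * (2 * y) ≡ 2 * (x * y)
    second = solve-∀
    split : ∀ s₀ b →
      ((if not s₀ ∨ not (false xor b) then C else 0) + (if not s₀ ∨ not (true xor b) then C else 0))
        * 2 ^ ((if s₀ then 1 else 0) + count (S ∘ suc)) ≡ 2 ^ suc n
    split false _     = trans (both C E) (cong (2 *_) IH)
    split true  false = trans (first C E) (cong (2 *_) IH)
    split true  true  = trans (second C E) (cong (2 *_) IH)

#sat-any : ∀ {n} k (bad : Fin k → (Fin n → Bool) → Bool) {T U} → (∀ x → #sat (bad x) * T ≤ U) →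
  #sat (λ σ → foldr _∨_ false (λ x → bad x σ)) * T ≤ k * U
#sat-any {n} zero bad {T} _ = ≤-reflexive (cong (_* T) (#sat-false n))
#sat-any {n} (suc k) bad {T} bounded = ≤-trans (*-monoˡ-≤ T (#sat-∨ {n} {q = bad zero} {r = rest} (λ _ e → e)))
  (≤-trans (≤-reflexive (*-distribʳ-+ T (#sat (bad zero)) (#sat rest)))
           (+-mono-≤ (bounded zero) (#sat-any k (bad ∘ suc) (bounded ∘ suc))))
  where
    rest : (Fin n → Bool) → Bool
    rest σ = foldr _∨_ false (λ x → bad (suc x) σ)

foldr-∨-false : ∀ {k} (f : Fin k → Bool) → foldr _∨_ false f ≡ false → ∀ x → f x ≡ false
foldr-∨-false f e zero    = ∨-conicalˡ _ _ e
foldr-∨-false f e (suc x) = foldr-∨-false (f ∘ suc) (∨-conicalʳ _ _ e) x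

-- σ is bad at x only if it is constant false on N x true or constant true on N x false, which
-- happens for at most 2 · 2ⁿ / 2ᴷ assignments; a union bound over x leaves a good σ.
alternatingAssignment : ∀ {n} (N : Fin n → Bool → Fin n → Bool) K → (∀ x h → K ≤ count (N x h)) → n + n < 2 ^ K →
  ∃ λ σ → ∀ x → ∃ λ y → N x (not (σ x)) y ≡ true × σ y ≡ not (σ x)
alternatingAssignment {n} N K large small = σ , λ x → constantOn-false _ _ σ (foldr-∨-false _ good x)
  where
    bad : Fin n → (Fin n → Bool) → Bool
    bad x σ = constantOn (N x (not (σ x))) (σ x) σ
    bad⇒ : ∀ x σ → bad x σ ≡ true → constantOn (N x true) false σ ∨ constantOn (N x false) true σ ≡ true
    bad⇒ x σ e with σ x
    ... | false = cong (_∨ constantOn (N x false) true σ) e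
    ... | true  = trans (cong (constantOn (N x true) false σ ∨_) e) (∨-zeroʳ _)
    rare : ∀ x h b → #sat (constantOn (N x h) b) * 2 ^ K ≤ 2 ^ n
    rare x h b = ≤-trans (*-monoʳ-≤ (#sat (constantOn (N x h) b)) (^-monoʳ-≤ 2 (large x h)))
                         (≤-reflexive (#sat-constantOn (N x h) b))
    bad-rare : ∀ x → #sat (bad x) * 2 ^ K ≤ 2 ^ n + 2 ^ n
    bad-rare x = ≤-trans (*-monoˡ-≤ (2 ^ K) (#sat-∨ {q = allFalse} {r = allTrue} (bad⇒ x)))
      (≤-trans (≤-reflexive (*-distribʳ-+ (2 ^ K) (#sat allFalse) (#sat allTrue)))
               (+-mono-≤ (rare x true false) (rare x false true)))
      where
        allFalse = constantOn (N x true) false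
        allTrue = constantOn (N x false) true
    anyBad : (Fin n → Bool) → Bool
    anyBad σ = foldr _∨_ false (λ x → bad x σ)
    rearrange : ∀ a b → a * (b + b) ≡ (a + a) * b
    rearrange = solve-∀
    fewBad : #sat anyBad < 2 ^ n
    fewBad = *-cancelʳ-< (2 ^ K) _ _ (begin-strict
      #sat anyBad * 2 ^ K   ≤⟨ #sat-any n bad bad-rare ⟩
      n * (2 ^ n + 2 ^ n)   ≡⟨ rearrange n (2 ^ n) ⟩
      (n + n) * 2 ^ n       <⟨ *-monoˡ-< (2 ^ n) {{m^n≢0 2 n}} small ⟩
      2 ^ K * 2 ^ n         ≡⟨ *-comm (2 ^ K) (2 ^ n) ⟩
      2 ^ n * 2 ^ K         ∎)
      where open ≤-Reasoning
    σ = proj₁ (#sat<⇒falsifiable anyBad fewBad)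
    good = proj₂ (#sat<⇒falsifiable anyBad fewBad)

bit : ∀ {c} → Bool → Fin (2 + c)
bit false = zero
bit true  = suc zero

bit-not : ∀ {c} b → bit {c} (not b) ≢ bit b
bit-not false ()
bit-not true  ()

isColor≡true : ∀ {c} (m : Maybe (Fin c)) i → isColor m i ≡ true → m ≡ just i
isColor≡true (just j) i e with j Fin.≟ i
... | yes refl = refl

alternatingSuccessor : ∀ {n c} (col : Colouring n (2 + c)) K → (∀ x i → K ≤ colDeg col x i) → n + n < 2 ^ K →
  Σ (Fin n → Fin n) (Alternating col)
alternatingSuccessor {n} col K large small = s , record
  { isArc = λ x e → case trans (sym (arc x)) e of λ () ; alternates = alternates }
  where
    assignment = alternatingAssignment (λ x h y → isColor (col x y) (bit h)) K (λ x h → large x (bit h)) small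
    σ = proj₁ assignment
    s : Fin n → Fin n
    s x = proj₁ (proj₂ assignment x)
    arc : ∀ x → col x (s x) ≡ just (bit (not (σ x)))
    arc x = isColor≡true _ _ (proj₁ (proj₂ (proj₂ assignment x)))
    flips : ∀ x → σ (s x) ≡ not (σ x)
    flips x = proj₂ (proj₂ (proj₂ assignment x))
    alternates : ∀ x → col x (s x) ≢ col (s x) (s (s x))
    alternates x e = bit-not (σ x) (just-injective (begin
      just (bit (not (σ x)))        ≡⟨ arc x ⟨
      col x (s x)                   ≡⟨ e ⟩
      col (s x) (s (s x))           ≡⟨ arc (s x) ⟩
      just (bit (not (σ (s x))))    ≡⟨ cong (just ∘ bit ∘ not) (flips x) ⟩
      just (bit (not (not (σ x))))  ≡⟨ cong (just ∘ bit) (not-involutive (σ x)) ⟩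
      just (bit (σ x))              ∎))
      where open ≡-Reasoning

forcesPC : ∀ {n c} K → suc n + suc n < 2 ^ K → ForcesPC (suc n) (2 + c) K
forcesPC K small G large =
  alternating⇒HasPCCycle (proj₂ (alternatingSuccessor (ECGraph.col G) K large small)) (ECGraph.symm G) zero

forcesPCDi : ∀ {n c} K → suc n + suc n < 2 ^ K → ForcesPCDi (suc n) (2 + c) K
forcesPCDi K small D large =
  alternating⇒HasPCDiCycle (proj₂ (alternatingSuccessor (ECDigraph.col D) K large small)) zero

-- Binary logarithms

n<2^n : ∀ n → n < 2 ^ n
n<2^n zero    = s≤s z≤n
n<2^n (suc n) = +-mono-≤ (m^n>0 2 n) (≤-trans (n<2^n n) (m≤m+n _ 0))

n<2^[1+⌊log₂n⌋] : ∀ n → n < 2 ^ suc ⌊log₂ n ⌋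
n<2^[1+⌊log₂n⌋] n with n <? 2 ^ suc ⌊log₂ n ⌋
... | yes lt = lt
... | no ¬lt = ⊥-elim (<-irrefl refl
  (≤-trans (≤-reflexive (sym (⌊log₂[2^n]⌋≡n (suc ⌊log₂ n ⌋)))) (⌊log₂⌋-mono-≤ (≮⇒≥ ¬lt))))

<⌊log₂⌋⇒2^≤ : ∀ {t n} → t < ⌊log₂ n ⌋ → 2 ^ t ≤ n
<⌊log₂⌋⇒2^≤ {t} {n} lt with n <? 2 ^ t
... | no ¬lt = ≮⇒≥ ¬lt
... | yes n<2^t = ⊥-elim (<-irrefl refl
  (<-≤-trans lt (≤-trans (⌊log₂⌋-mono-≤ (<⇒≤ n<2^t)) (≤-reflexive (⌊log₂[2^n]⌋≡n t)))))

n+n<2^[⌊log₂n⌋+2] : ∀ n → n + n < 2 ^ (⌊log₂ n ⌋ + 2)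
n+n<2^[⌊log₂n⌋+2] n = begin-strict
  n + n                                 <⟨ +-mono-< (n<2^[1+⌊log₂n⌋] n) (n<2^[1+⌊log₂n⌋] n) ⟩
  2 ^ suc ⌊log₂ n ⌋ + 2 ^ suc ⌊log₂ n ⌋ ≡⟨ cong (2 ^ suc ⌊log₂ n ⌋ +_) (+-identityʳ _) ⟨
  2 ^ suc (suc ⌊log₂ n ⌋)               ≡⟨ cong (2 ^_) (+-comm 2 ⌊log₂ n ⌋) ⟩
  2 ^ (⌊log₂ n ⌋ + 2)                   ∎
  where open ≤-Reasoning

⌊log₂n⌋+2≤3*⌊log₂n⌋ : ∀ n → 2 ≤ n → ⌊log₂ n ⌋ + 2 ≤ 3 * ⌊log₂ n ⌋
⌊log₂n⌋+2≤3*⌊log₂n⌋ n 2≤n = +-monoʳ-≤ ⌊log₂ n ⌋ (+-mono-≤ 1≤L (≤-trans 1≤L (m≤m+n _ 0)))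
  where
    1≤L : 1 ≤ ⌊log₂ n ⌋
    1≤L = ⌊log₂⌋-mono-≤ {2} 2≤n

-- Otherwise 2^((c+1)ck) ≤ n, which leaves room for the PC-free construction with demand k.
⌊log₂⌋≤-of-forcing : ∀ {n c k} → (∀ (col : Colouring n c) → Loopless col → Undirected col →
  (∀ x i → k ≤ colDeg col x i) → Σ ℕ (PCCycle col)) → ⌊log₂ n ⌋ ≤ suc c * c * k
⌊log₂⌋≤-of-forcing {n} {c} {k} forces with ⌊log₂ n ⌋ ≤? suc c * c * k
... | yes le = le
... | no ¬le = ⊥-elim (pcFree (proj₁ cycle) (proj₂ cycle))
  where
    large : (2 + c) ^ (c * k) ≤ n
    large = begin
      (2 + c) ^ (c * k)        ≤⟨ ^-monoˡ-≤ (c * k) (n<2^n (suc c)) ⟩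
      (2 ^ suc c) ^ (c * k)    ≡⟨ ^-*-assoc 2 (suc c) (c * k) ⟩
      2 ^ (suc c * (c * k))    ≡⟨ cong (2 ^_) (*-assoc (suc c) c k) ⟨
      2 ^ (suc c * c * k)      ≤⟨ <⌊log₂⌋⇒2^≤ (≰⇒> ¬le) ⟩
      n                        ∎
      where open ≤-Reasoning
    open PCFreeGraph (pcFreeGraph c k n large)
    cycle = forces colour loopless undirected minColDeg

IsD-bounds : ∀ c n k → 2 ≤ n → IsD n (2 + c) k → ⌊log₂ n ⌋ ≤ suc (2 + c) * (2 + c) * k × k ≤ 3 * ⌊log₂ n ⌋
IsD-bounds c n@(suc _) k 2≤n (forcing , minimal) =
  ⌊log₂⌋≤-of-forcing forces ,
  ≤-trans (minimal _ (forcesPC _ (n+n<2^[⌊log₂n⌋+2] n))) (⌊log₂n⌋+2≤3*⌊log₂n⌋ n 2≤n)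
  where
    forces : ∀ col → Loopless col → Undirected col → (∀ x i → k ≤ colDeg col x i) → Σ ℕ (PCCycle col)
    forces col loopless undirected large =
      let m , _ , C = forcing (record { col = col ; irrefl = loopless ; symm = undirected }) large in m , C

IsDiD-bounds : ∀ c n k → 2 ≤ n → IsDiD n (2 + c) k → ⌊log₂ n ⌋ ≤ suc (2 + c) * (2 + c) * k × k ≤ 3 * ⌊log₂ n ⌋
IsDiD-bounds c n@(suc _) k 2≤n (forcing , minimal) =
  ⌊log₂⌋≤-of-forcing forces ,
  ≤-trans (minimal _ (forcesPCDi _ (n+n<2^[⌊log₂n⌋+2] n))) (⌊log₂n⌋+2≤3*⌊log₂n⌋ n 2≤n)
  where
    forces : ∀ col → Loopless col → Undirected col → (∀ x i → k ≤ colDeg col x i) → Σ ℕ (PCCycle col)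
    forces col loopless _ large =
      let m , _ , C = forcing (record { col = col ; irrefl = loopless }) large in m , C

mainTheorem5 : (c : ℕ) → 2 ≤ c →
    Σ ℕ (λ p → Σ ℕ (λ q → Σ ℕ (λ N → (n : ℕ) → N ≤ n →
      ((k : ℕ) → IsD n c k → (⌊log₂ n ⌋ ≤ p * k) × (k ≤ q * ⌊log₂ n ⌋))
      × ((k : ℕ) → IsDiD n c k → (⌊log₂ n ⌋ ≤ p * k) × (k ≤ q * ⌊log₂ n ⌋)))))
mainTheorem5 (suc (suc c)) (s≤s (s≤s z≤n)) =
  suc (2 + c) * (2 + c) , 3 , 2 , λ n 2≤n → (λ k → IsD-bounds c n k 2≤n) , (λ k → IsDiD-bounds c n k 2≤n)
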